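{- Let the syntactic classes $\mathcal{B},\mathcal{C},\mathcal{D},\mathcal{E}$ and the functions $\mathrm{plus},\mathrm{times},\mathrm{dist}_1,\mathrm{exp}_1,\mathrm{exp},\mathrm{dist}$ be as in the context. Then, for all $b\in\mathcal{B}$, $c,c_1,c_2,c_3\in\mathcal{C}$, $d\in\mathcal{D}$, $e,e_0,e_1,e_2,e_3\in\mathcal{E}$, the following equalities hold (where $=$ is syntactic equality after evaluating the functions, modulo commutativity of multiplication): \begin{align*} &\mathrm{times}(c,1)=c\\ &\mathrm{times}(c_1,\mathrm{times}(c_2,c_3))=\mathrm{times}(\mathrm{times}(c_1,c_2),c_3)\\ &\mathrm{plus}(d,\mathrm{plus}(e_2,e_3))=\mathrm{plus}(\mathrm{plus}(d,e_2),e_3)\\ &\mathrm{plus}(e_1,\mathrm{plus}(e_2,e_3))=\mathrm{plus}(\mathrm{plus}(e_1,e_2),e_3)\\ &\mathrm{dist}_1(c,\mathrm{plus}(d,e))=\mathrm{plus}(\mathrm{dist}_1(c,d),\mathrm{dist}_1(c,e))\\ &\mathrm{dist}_1(c,\mathrm{plus}(e_1,e_2))=\mathrm{plus}(\mathrm{dist}_1(c,e_1),\mathrm{dist}_1(c,e_2))\\ &\mathrm{dist}(\mathrm{plus}(d,e_1),e_2)=\mathrm{plus}(\mathrm{dist}(d,e_2),\mathrm{dist}(e_1,e_2))\\ &\mathrm{dist}(\mathrm{plus}(e_0,e_1),e_2)=\mathrm{plus}(\mathrm{dist}(e_0,e_2),\mathrm{dist}(e_1,e_2))\\ &\mathrm{dist}_1(1,e)=e\\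 &\mathrm{dist}_1(c_1,\mathrm{dist}_1(c_2,d))=\mathrm{dist}_1(\mathrm{times}(c_1,c_2),d)\\ &\mathrm{dist}_1(c_1,\mathrm{dist}_1(c_2,e))=\mathrm{dist}_1(\mathrm{times}(c_1,c_2),e)\\ &\mathrm{dist}_1(c,\mathrm{dist}(d,e))=\mathrm{dist}(\mathrm{dist}_1(c,d),e)\\ &\mathrm{dist}_1(c,\mathrm{dist}(e_1,e_2))=\mathrm{dist}(\mathrm{dist}_1(c,e_1),e_2)\\ &\mathrm{dist}(d,\mathrm{dist}(e_1,e_2))=\mathrm{dist}(\mathrm{dist}(d,e_1),e_2)\\ &\mathrm{dist}(e_1,\mathrm{dist}(e_2,e_3))=\mathrm{dist}(\mathrm{dist}(e_1,e_2),e_3)\\ &\mathrm{exp}(c,1)=c\\ &\mathrm{exp}(\mathrm{times}(c_1,c_2),e)=\mathrm{times}(\mathrm{exp}(c_1,e),\mathrm{exp}(c_2,e))\\ &\mathrm{exp}_1(b,\mathrm{plus}(d,e))=\mathrm{times}(\mathrm{exp}_1(b,d),\mathrm{exp}_1(b,e))\\ &\mathrm{exp}_1(b,\mathrm{plus}(e_1,e_2))=\mathrm{times}(\mathrm{exp}_1(b,e_1),\mathrm{exp}_1(b,e_2))\\ &\mathrm{exp}_1(b,\mathrm{dist}(e_1,e_2))=\mathrm{exp}(\mathrm{exp}_1(b,e_1),e_2)\\ &\mathrm{exp}(c,\mathrm{dist}(e_1,e_2))=\mathrm{exp}(\mathrm{exp}(c,e_1),e_2)\\ &\mathrm{exp}(c,\mathrm{plus}(e_1,e_2))=\mathrm{times}(\mathrm{exp}(c,e_1),\mathrm{exp}(c,e_2))\\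 &\mathrm{exp}(c,\mathrm{dist}(\mathrm{plus}(e_1,e_2),e_3))=\mathrm{times}(\mathrm{exp}(c,\mathrm{dist}(e_1,e_3)),\mathrm{exp}(c,\mathrm{dist}(e_2,e_3))). \end{align*}
   Context: Syntax (with $p$ ranging over prime formulas): $\mathcal{B}\ni b ::= p ~|~ d$; $\mathcal{C}\ni c ::= 1 ~|~ b^{c_1}c_2$ (a right-nested list of factors $b^{c_1}$ terminated by the empty product $1$); $\mathcal{D}\ni d ::= c_1 + c_2 ~|~ c + d$; $\mathcal{E}\ni e ::= c ~|~ d$. Here $1$, $b^{c_1}c_2$ and $+$ are formal constructors. Functions (defined by the displayed clauses, by structural recursion): $\mathrm{plus}:\mathcal{E}\times\mathcal{E}\to\mathcal{D}$: $\mathrm{plus}(c_1,e_2)=c_1+e_2$; $\mathrm{plus}(c_{11}+c_{12},e_2)=c_{11}+(c_{12}+e_2)$; $\mathrm{plus}(c_{11}+d_{12},e_2)=c_{11}+\mathrm{plus}(d_{12},e_2)$. $\mathrm{times}:\mathcal{C}\times\mathcal{C}\to\mathcal{C}$: $\mathrm{times}(1,c_2)=c_2$; $\mathrm{times}(b^{c_{11}}c_{12},c_2)=b^{c_{11}}\,\mathrm{times}(c_{12},c_2)$. $\mathrm{dist}_1:\mathcal{C}\times\mathcal{E}\to\mathcal{E}$: $\mathrm{dist}_1(c_1,c_2)=\mathrm{times}(c_1,c_2)$; $\mathrm{dist}_1(c_1,c_{21}+c_{22})=\mathrm{times}(c_1,c_{21})+\mathrm{times}(c_1,c_{22})$; $\mathrm{dist}_1(c_1,c_{21}+d_{22})=\mathrm{times}(c_1,c_{21})+\mathrm{dist}_1(c_1,d_{22})$.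 $\mathrm{exp}_1:\mathcal{B}\times\mathcal{E}\to\mathcal{C}$: $\mathrm{exp}_1(b,c)=b^c1$; $\mathrm{exp}_1(b,c_1+c_2)=\mathrm{times}(b^{c_1}1,b^{c_2}1)$; $\mathrm{exp}_1(b,c_1+d_2)=\mathrm{times}(b^{c_1}1,\mathrm{exp}_1(b,d_2))$. $\mathrm{exp}:\mathcal{C}\times\mathcal{E}\to\mathcal{C}$: $\mathrm{exp}(1,e_2)=1$; $\mathrm{exp}(b^{c_{11}}c_{12},e_2)=\mathrm{times}(\mathrm{exp}_1(b,\mathrm{dist}_1(c_{11},e_2)),\mathrm{exp}(c_{12},e_2))$. $\mathrm{dist}:\mathcal{E}\times\mathcal{E}\to\mathcal{E}$: $\mathrm{dist}(c_1,e_2)=\mathrm{dist}_1(c_1,e_2)$; $\mathrm{dist}(c_{11}+c_{12},e_2)=\mathrm{plus}(\mathrm{dist}_1(c_{11},e_2),\mathrm{dist}_1(c_{12},e_2))$; $\mathrm{dist}(c_{11}+d_{12},e_2)=\mathrm{plus}(\mathrm{dist}_1(c_{11},e_2),\mathrm{dist}(d_{12},e_2))$. (Intended reading: $\mathrm{plus}$ = addition/disjunction, $\mathrm{times}$ and $\mathrm{dist}_1,\mathrm{dist}$ = multiplication/conjunction, $\mathrm{exp}_1(b,e)=b^e$, $\mathrm{exp}(c,e)=c^e$.) "Modulo commutativity of multiplication" means equality of expressions up to the least congruence containing $b^{c_1}(b'^{c_2}c)\sim b'^{c_2}(b^{c_1}c)$ (permutation of factors in products). -}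

module Defs where

-- Syntax of normal forms, parametrised by a type P of prime formulas.
--   B ::= p | d      C ::= 1 | b^{c1} c2      D ::= c1 + c2 | c + d      E ::= c | d

module _ {P : Set} where

  data B : Set
  data C : Set
  data D : Set

  data B where
    prim : P → B
    dB   : D → B

  data C where
    one : C
    fac : B → C → C → C     -- fac b c1 c2  =  b^{c1} c2

  data D where
    _⊕_  : C → C → D
    _⊕d_ : C → D → D

  data E : Set where
    eC : C → E
    eD : D → E

  infixr 5 _⊕_ _⊕d_

  cons : C → E → D
  cons c (eC c') = c ⊕ c'
  cons c (eD d)  = c ⊕d d

  plusD : D → E → D
  plusD (c11 ⊕ c12)  e2 = c11 ⊕d cons c12 e2
  plusD (c11 ⊕d d12) e2 = c11 ⊕d plusD d12 e2

  plus : E → E → D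
  plus (eC c1) e2 = cons c1 e2
  plus (eD d1) e2 = plusD d1 e2

  times : C → C → C
  times one c2 = c2
  times (fac b c11 c12) c2 = fac b c11 (times c12 c2)

  dist1D : C → D → D
  dist1D c1 (c21 ⊕ c22)  = times c1 c21 ⊕ times c1 c22
  dist1D c1 (c21 ⊕d d22) = times c1 c21 ⊕d dist1D c1 d22

  dist1 : C → E → E
  dist1 c1 (eC c2) = eC (times c1 c2)
  dist1 c1 (eD d2) = eD (dist1D c1 d2)

  exp1D : B → D → C
  exp1D b (c1 ⊕ c2)  = times (fac b c1 one) (fac b c2 one)
  exp1D b (c1 ⊕d d2) = times (fac b c1 one) (exp1D b d2)

  exp1 : B → E → C
  exp1 b (eC c) = fac b c one
  exp1 b (eD d) = exp1D b d

  exp : C → E → C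
  exp one e2 = one
  exp (fac b c11 c12) e2 = times (exp1 b (dist1 c11 e2)) (exp c12 e2)

  distD : D → E → E
  distD (c11 ⊕ c12)  e2 = eD (plus (dist1 c11 e2) (dist1 c12 e2))
  distD (c11 ⊕d d12) e2 = eD (plus (dist1 c11 e2) (distD d12 e2))

  dist : E → E → E
  dist (eC c1) e2 = dist1 c1 e2
  dist (eD d1) e2 = distD d1 e2

  data _≈B_ : B → B → Set
  data _≈C_ : C → C → Set
  data _≈D_ : D → D → Set

  data _≈B_ where
    reflB  : ∀ {b} → b ≈B b
    symB   : ∀ {b b'} → b ≈B b' → b' ≈B b
    transB : ∀ {b b' b''} → b ≈B b' → b' ≈B b'' → b ≈B b''
    dB-cong : ∀ {d d'} → d ≈D d' → dB d ≈B dB d'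

  data _≈C_ where
    reflC  : ∀ {c} → c ≈C c
    symC   : ∀ {c c'} → c ≈C c' → c' ≈C c
    transC : ∀ {c c' c''} → c ≈C c' → c' ≈C c'' → c ≈C c''
    fac-cong : ∀ {b b' c1 c1' c2 c2'} → b ≈B b' → c1 ≈C c1' → c2 ≈C c2' →
               fac b c1 c2 ≈C fac b' c1' c2'
    swap : ∀ b c1 b' c2 c → fac b c1 (fac b' c2 c) ≈C fac b' c2 (fac b c1 c)

  data _≈D_ where
    reflD  : ∀ {d} → d ≈D d
    symD   : ∀ {d d'} → d ≈D d' → d' ≈D d
    transD : ∀ {d d' d''} → d ≈D d' → d' ≈D d'' → d ≈D d''
    ⊕-cong  : ∀ {c1 c1' c2 c2'} → c1 ≈C c1' → c2 ≈C c2' → (c1 ⊕ c2) ≈D (c1' ⊕ c2')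
    ⊕d-cong : ∀ {c c' d d'} → c ≈C c' → d ≈D d' → (c ⊕d d) ≈D (c' ⊕d d')

  data _≈E_ : E → E → Set where
    eC-cong : ∀ {c c'} → c ≈C c' → eC c ≈E eC c'
    eD-cong : ∀ {d d'} → d ≈D d' → eD d ≈E eD d'

  infix 4 _≈B_ _≈C_ _≈D_ _≈E_

module Submission where

-- All laws except the two distributing exp over a sum hold up to *syntactic*
-- equality (≡).  Products are right-nested lists of factors, so times is list
-- append (unit and associativity); sums are right-nested lists of summands,
-- so plus is append too; dist₁ maps "multiply on the left" over summands and
-- dist is built from dist₁ and plus.
--
-- The exponential law c^(e₁+e₂) = c^e₁ · c^e₂ needs to reorder factors: it
-- is proved modulo ≈C, using commutativity of times (derived from the swap
-- generator of ≈C) in the form of the interchange law (a₁a₂)(b₁b₂) ≈ (a₁b₁)(a₂b₂).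

open import Defs
open import Data.Product using (_×_; _,_)
open import Level using (0ℓ)
open import Relation.Binary.Bundles using (Setoid)
open import Relation.Binary.PropositionalEquality
  using (_≡_; refl; sym; cong; cong₂; module ≡-Reasoning)
import Relation.Binary.Reasoning.Setoid as SetoidReasoning

module NormalFormLaws {P : Set} where

  times-identityʳ : (c : C {P}) → times c one ≡ c
  times-identityʳ one         = refl
  times-identityʳ (fac b x y) = cong (fac b x) (times-identityʳ y)

  times-assoc : (c1 c2 c3 : C {P}) → times c1 (times c2 c3) ≡ times (times c1 c2) c3
  times-assoc one         c2 c3 = refl
  times-assoc (fac b x y) c2 c3 = cong (fac b x) (times-assoc y c2 c3)

  plusD-cons : (c : C {P}) (e e' : E {P}) → plusD (cons c e) e' ≡ c ⊕d plus e e'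
  plusD-cons c (eC _) e' = refl
  plusD-cons c (eD _) e' = refl

  plus-assoc : (e1 e2 e3 : E {P}) → plus e1 (eD (plus e2 e3)) ≡ plus (eD (plus e1 e2)) e3
  plus-assoc (eC c)         e2 e3 = sym (plusD-cons c e2 e3)
  plus-assoc (eD (c ⊕ c'))  e2 e3 = cong (c ⊕d_) (plus-assoc (eC c') e2 e3)
  plus-assoc (eD (c ⊕d d))  e2 e3 = cong (c ⊕d_) (plus-assoc (eD d) e2 e3)

  dist1D-cons : (c c' : C {P}) (e : E {P}) →
                dist1D c (cons c' e) ≡ cons (times c c') (dist1 c e)
  dist1D-cons c c' (eC _) = refl
  dist1D-cons c c' (eD _) = refl

  dist1D-plus : (c : C {P}) (e1 e2 : E {P}) →
                dist1D c (plus e1 e2) ≡ plus (dist1 c e1) (dist1 c e2)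
  dist1D-plus c (eC x)        e2 = dist1D-cons c x e2
  dist1D-plus c (eD (x ⊕ y))  e2 = cong (times c x ⊕d_) (dist1D-plus c (eC y) e2)
  dist1D-plus c (eD (x ⊕d d)) e2 = cong (times c x ⊕d_) (dist1D-plus c (eD d) e2)

  dist1-plus : (c : C {P}) (e1 e2 : E {P}) →
               dist1 c (eD (plus e1 e2)) ≡ eD (plus (dist1 c e1) (dist1 c e2))
  dist1-plus c e1 e2 = cong eD (dist1D-plus c e1 e2)

  dist1-identityˡ : (e : E {P}) → dist1 one e ≡ e
  dist1-identityˡ (eC c) = refl
  dist1-identityˡ (eD d) = cong eD (dist1D-one d)
    where
      dist1D-one : (d : D {P}) → dist1D one d ≡ d
      dist1D-one (x ⊕ y)  = refl
      dist1D-one (x ⊕d d) = cong (x ⊕d_) (dist1D-one d)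

  dist1-times : (c1 c2 : C {P}) (e : E {P}) → dist1 c1 (dist1 c2 e) ≡ dist1 (times c1 c2) e
  dist1-times c1 c2 (eC c) = cong eC (times-assoc c1 c2 c)
  dist1-times c1 c2 (eD d) = cong eD (dist1D-times d)
    where
      dist1D-times : (d : D {P}) → dist1D c1 (dist1D c2 d) ≡ dist1D (times c1 c2) d
      dist1D-times (x ⊕ y)  = cong₂ _⊕_  (times-assoc c1 c2 x) (times-assoc c1 c2 y)
      dist1D-times (x ⊕d d) = cong₂ _⊕d_ (times-assoc c1 c2 x) (dist1D-times d)

  distD-cons : (c : C {P}) (e1 e2 : E {P}) →
               distD (cons c e1) e2 ≡ eD (plus (dist1 c e2) (dist e1 e2))
  distD-cons c (eC _) e2 = refl
  distD-cons c (eD _) e2 = refl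

  dist-plus : (e0 e1 e2 : E {P}) →
              dist (eD (plus e0 e1)) e2 ≡ eD (plus (dist e0 e2) (dist e1 e2))
  dist-plus (eC c)        e1 e2 = distD-cons c e1 e2
  dist-plus (eD (c ⊕ c')) e1 e2 = begin
    eD (plus (dist1 c e2) (dist (eD (plus (eC c') e1)) e2))
      ≡⟨ cong (λ s → eD (plus (dist1 c e2) s)) (dist-plus (eC c') e1 e2) ⟩
    eD (plus (dist1 c e2) (eD (plus (dist1 c' e2) (dist e1 e2))))
      ≡⟨ cong eD (plus-assoc (dist1 c e2) (dist1 c' e2) (dist e1 e2)) ⟩
    eD (plus (eD (plus (dist1 c e2) (dist1 c' e2))) (dist e1 e2)) ∎
    where open ≡-Reasoning
  dist-plus (eD (c ⊕d d)) e1 e2 = begin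
    eD (plus (dist1 c e2) (dist (eD (plus (eD d) e1)) e2))
      ≡⟨ cong (λ s → eD (plus (dist1 c e2) s)) (dist-plus (eD d) e1 e2) ⟩
    eD (plus (dist1 c e2) (eD (plus (distD d e2) (dist e1 e2))))
      ≡⟨ cong eD (plus-assoc (dist1 c e2) (distD d e2) (dist e1 e2)) ⟩
    eD (plus (eD (plus (dist1 c e2) (distD d e2))) (dist e1 e2)) ∎
    where open ≡-Reasoning

  dist1-dist : (c : C {P}) (e1 e2 : E {P}) → dist1 c (dist e1 e2) ≡ dist (dist1 c e1) e2
  dist1-dist c (eC x)        e2 = dist1-times c x e2
  dist1-dist c (eD (x ⊕ y))  e2 = begin
    dist1 c (eD (plus (dist1 x e2) (dist1 y e2)))
      ≡⟨ dist1-plus c (dist1 x e2) (dist1 y e2) ⟩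
    eD (plus (dist1 c (dist1 x e2)) (dist1 c (dist1 y e2)))
      ≡⟨ cong₂ (λ u v → eD (plus u v)) (dist1-times c x e2) (dist1-times c y e2) ⟩
    eD (plus (dist1 (times c x) e2) (dist1 (times c y) e2)) ∎
    where open ≡-Reasoning
  dist1-dist c (eD (x ⊕d d)) e2 = begin
    dist1 c (eD (plus (dist1 x e2) (distD d e2)))
      ≡⟨ dist1-plus c (dist1 x e2) (distD d e2) ⟩
    eD (plus (dist1 c (dist1 x e2)) (dist1 c (distD d e2)))
      ≡⟨ cong₂ (λ u v → eD (plus u v)) (dist1-times c x e2) (dist1-dist c (eD d) e2) ⟩
    eD (plus (dist1 (times c x) e2) (dist (dist1 c (eD d)) e2)) ∎
    where open ≡-Reasoning

  dist-assoc : (e1 e2 e3 : E {P}) → dist e1 (dist e2 e3) ≡ dist (dist e1 e2) e3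
  dist-assoc (eC c)        e2 e3 = dist1-dist c e2 e3
  dist-assoc (eD (x ⊕ y))  e2 e3 = begin
    eD (plus (dist1 x (dist e2 e3)) (dist1 y (dist e2 e3)))
      ≡⟨ cong₂ (λ u v → eD (plus u v)) (dist1-dist x e2 e3) (dist1-dist y e2 e3) ⟩
    eD (plus (dist (dist1 x e2) e3) (dist (dist1 y e2) e3))
      ≡⟨ sym (dist-plus (dist1 x e2) (dist1 y e2) e3) ⟩
    dist (eD (plus (dist1 x e2) (dist1 y e2))) e3 ∎
    where open ≡-Reasoning
  dist-assoc (eD (x ⊕d d)) e2 e3 = begin
    eD (plus (dist1 x (dist e2 e3)) (distD d (dist e2 e3)))
      ≡⟨ cong₂ (λ u v → eD (plus u v)) (dist1-dist x e2 e3) (dist-assoc (eD d) e2 e3) ⟩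
    eD (plus (dist (dist1 x e2) e3) (dist (distD d e2) e3))
      ≡⟨ sym (dist-plus (dist1 x e2) (distD d e2) e3) ⟩
    dist (eD (plus (dist1 x e2) (distD d e2))) e3 ∎
    where open ≡-Reasoning

  exp-identityʳ : (c : C {P}) → exp c (eC one) ≡ c
  exp-identityʳ one         = refl
  exp-identityʳ (fac b x y) = cong₂ (fac b) (times-identityʳ x) (exp-identityʳ y)

  exp-times : (c1 c2 : C {P}) (e : E {P}) → exp (times c1 c2) e ≡ times (exp c1 e) (exp c2 e)
  exp-times one         c2 e = refl
  exp-times (fac b x y) c2 e = begin
    times (exp1 b (dist1 x e)) (exp (times y c2) e)
      ≡⟨ cong (times (exp1 b (dist1 x e))) (exp-times y c2 e) ⟩
    times (exp1 b (dist1 x e)) (times (exp y e) (exp c2 e))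
      ≡⟨ times-assoc (exp1 b (dist1 x e)) (exp y e) (exp c2 e) ⟩
    times (times (exp1 b (dist1 x e)) (exp y e)) (exp c2 e) ∎
    where open ≡-Reasoning

  exp-factor : (b : B {P}) (c : C {P}) (e : E {P}) → exp (fac b c one) e ≡ exp1 b (dist1 c e)
  exp-factor b c e = times-identityʳ (exp1 b (dist1 c e))

  exp1D-cons : (b : B {P}) (c : C {P}) (e : E {P}) →
               exp1D b (cons c e) ≡ times (fac b c one) (exp1 b e)
  exp1D-cons b c (eC _) = refl
  exp1D-cons b c (eD _) = refl

  exp1-plus : (b : B {P}) (e1 e2 : E {P}) →
              exp1 b (eD (plus e1 e2)) ≡ times (exp1 b e1) (exp1 b e2)
  exp1-plus b (eC c)        e2 = exp1D-cons b c e2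
  exp1-plus b (eD (c ⊕ c')) e2 = begin
    times (fac b c one) (exp1D b (cons c' e2))
      ≡⟨ cong (times (fac b c one)) (exp1-plus b (eC c') e2) ⟩
    times (fac b c one) (times (fac b c' one) (exp1 b e2))
      ≡⟨ times-assoc (fac b c one) (fac b c' one) (exp1 b e2) ⟩
    times (times (fac b c one) (fac b c' one)) (exp1 b e2) ∎
    where open ≡-Reasoning
  exp1-plus b (eD (c ⊕d d)) e2 = begin
    times (fac b c one) (exp1D b (plusD d e2))
      ≡⟨ cong (times (fac b c one)) (exp1-plus b (eD d) e2) ⟩
    times (fac b c one) (times (exp1D b d) (exp1 b e2))
      ≡⟨ times-assoc (fac b c one) (exp1D b d) (exp1 b e2) ⟩
    times (times (fac b c one) (exp1D b d)) (exp1 b e2) ∎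
    where open ≡-Reasoning

  exp1-dist : (b : B {P}) (e1 e2 : E {P}) → exp1 b (dist e1 e2) ≡ exp (exp1 b e1) e2
  exp1-dist b (eC c)        e2 = sym (exp-factor b c e2)
  exp1-dist b (eD (x ⊕ y))  e2 = begin
    exp1 b (eD (plus (dist1 x e2) (dist1 y e2)))
      ≡⟨ exp1-plus b (dist1 x e2) (dist1 y e2) ⟩
    times (exp1 b (dist1 x e2)) (exp1 b (dist1 y e2))
      ≡⟨ cong₂ times (sym (exp-factor b x e2)) (sym (exp-factor b y e2)) ⟩
    times (exp (fac b x one) e2) (exp (fac b y one) e2)
      ≡⟨ sym (exp-times (fac b x one) (fac b y one) e2) ⟩
    exp (times (fac b x one) (fac b y one)) e2 ∎
    where open ≡-Reasoning
  exp1-dist b (eD (x ⊕d d)) e2 = begin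
    exp1 b (eD (plus (dist1 x e2) (distD d e2)))
      ≡⟨ exp1-plus b (dist1 x e2) (distD d e2) ⟩
    times (exp1 b (dist1 x e2)) (exp1 b (distD d e2))
      ≡⟨ cong₂ times (sym (exp-factor b x e2)) (exp1-dist b (eD d) e2) ⟩
    times (exp (fac b x one) e2) (exp (exp1D b d) e2)
      ≡⟨ sym (exp-times (fac b x one) (exp1D b d) e2) ⟩
    exp (times (fac b x one) (exp1D b d)) e2 ∎
    where open ≡-Reasoning

  exp-dist : (c : C {P}) (e1 e2 : E {P}) → exp c (dist e1 e2) ≡ exp (exp c e1) e2
  exp-dist one         e1 e2 = refl
  exp-dist (fac b x y) e1 e2 = begin
    times (exp1 b (dist1 x (dist e1 e2))) (exp y (dist e1 e2))
      ≡⟨ cong (λ u → times (exp1 b u) (exp y (dist e1 e2))) (dist1-dist x e1 e2) ⟩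
    times (exp1 b (dist (dist1 x e1) e2)) (exp y (dist e1 e2))
      ≡⟨ cong₂ times (exp1-dist b (dist1 x e1) e2) (exp-dist y e1 e2) ⟩
    times (exp (exp1 b (dist1 x e1)) e2) (exp (exp y e1) e2)
      ≡⟨ sym (exp-times (exp1 b (dist1 x e1)) (exp y e1) e2) ⟩
    exp (times (exp1 b (dist1 x e1)) (exp y e1)) e2 ∎
    where open ≡-Reasoning

  ≈C-setoid : Setoid 0ℓ 0ℓ
  ≈C-setoid = record
    { Carrier       = C {P}
    ; _≈_           = _≈C_
    ; isEquivalence = record { refl = reflC ; sym = symC ; trans = transC }
    }

  ≡⇒≈C : {x y : C {P}} → x ≡ y → x ≈C y
  ≡⇒≈C refl = reflC

  ≡⇒≈E : {x y : E {P}} → x ≡ y → x ≈E y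
  ≡⇒≈E {eC _} refl = eC-cong reflC
  ≡⇒≈E {eD _} refl = eD-cong reflD

  times-congʳ : (x : C {P}) {y y' : C {P}} → y ≈C y' → times x y ≈C times x y'
  times-congʳ one         y≈y' = y≈y'
  times-congʳ (fac b a z) y≈y' = fac-cong reflB reflC (times-congʳ z y≈y')

  times-pull : (y : C {P}) (b : B {P}) (a z : C {P}) →
               times y (fac b a z) ≈C fac b a (times y z)
  times-pull one           b a z = reflC
  times-pull (fac b' a' y) b a z =
    transC (fac-cong reflB reflC (times-pull y b a z)) (swap b' a' b a (times y z))

  times-comm : (x y : C {P}) → times x y ≈C times y x
  times-comm one         y = symC (≡⇒≈C (times-identityʳ y))
  times-comm (fac b a x) y =
    transC (fac-cong reflB reflC (times-comm x y)) (symC (times-pull y b a x))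

  times-interchange : (a1 a2 b1 b2 : C {P}) →
                      times (times a1 a2) (times b1 b2) ≈C times (times a1 b1) (times a2 b2)
  times-interchange a1 a2 b1 b2 = begin
    times (times a1 a2) (times b1 b2)  ≡⟨ sym (times-assoc a1 a2 (times b1 b2)) ⟩
    times a1 (times a2 (times b1 b2))  ≈⟨ times-congʳ a1 (times-comm a2 (times b1 b2)) ⟩
    times a1 (times (times b1 b2) a2)  ≡⟨ cong (times a1) (sym (times-assoc b1 b2 a2)) ⟩
    times a1 (times b1 (times b2 a2))  ≈⟨ times-congʳ a1 (times-congʳ b1 (times-comm b2 a2)) ⟩
    times a1 (times b1 (times a2 b2))  ≡⟨ times-assoc a1 b1 (times a2 b2) ⟩
    times (times a1 b1) (times a2 b2)  ∎
    where open SetoidReasoning ≈C-setoid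

  -- c^(e₁+e₂) ≈ c^e₁ c^e₂: each factor b^x becomes b^(x·e₁) b^(x·e₂), and the
  -- resulting factors must be regrouped, which needs commutativity.
  exp-plus : (c : C {P}) (e1 e2 : E {P}) → exp c (eD (plus e1 e2)) ≈C times (exp c e1) (exp c e2)
  exp-plus one         e1 e2 = reflC
  exp-plus (fac b x y) e1 e2 = begin
    times (exp1 b (dist1 x (eD (plus e1 e2)))) (exp y (eD (plus e1 e2)))
      ≡⟨ cong (λ u → times (exp1 b u) (exp y (eD (plus e1 e2)))) (dist1-plus x e1 e2) ⟩
    times (exp1 b (eD (plus (dist1 x e1) (dist1 x e2)))) (exp y (eD (plus e1 e2)))
      ≡⟨ cong (λ u → times u (exp y (eD (plus e1 e2)))) (exp1-plus b (dist1 x e1) (dist1 x e2)) ⟩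
    times (times X1 X2) (exp y (eD (plus e1 e2)))
      ≈⟨ times-congʳ (times X1 X2) (exp-plus y e1 e2) ⟩
    times (times X1 X2) (times (exp y e1) (exp y e2))
      ≈⟨ times-interchange X1 X2 (exp y e1) (exp y e2) ⟩
    times (times X1 (exp y e1)) (times X2 (exp y e2)) ∎
    where
      open SetoidReasoning ≈C-setoid
      X1 X2 : C {P}
      X1 = exp1 b (dist1 x e1)
      X2 = exp1 b (dist1 x e2)

open NormalFormLaws

lemma2 : (P : Set) (b : B {P}) (c c1 c2 c3 : C {P}) (d : D {P}) (e e0 e1 e2 e3 : E {P}) →
    (times c one ≈C c)
    × (times c1 (times c2 c3) ≈C times (times c1 c2) c3)
    × (eD (plus (eD d) (eD (plus e2 e3))) ≈E eD (plus (eD (plus (eD d) e2)) e3))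
    × (eD (plus e1 (eD (plus e2 e3))) ≈E eD (plus (eD (plus e1 e2)) e3))
    × (dist1 c (eD (plus (eD d) e)) ≈E eD (plus (dist1 c (eD d)) (dist1 c e)))
    × (dist1 c (eD (plus e1 e2)) ≈E eD (plus (dist1 c e1) (dist1 c e2)))
    × (dist (eD (plus (eD d) e1)) e2 ≈E eD (plus (dist (eD d) e2) (dist e1 e2)))
    × (dist (eD (plus e0 e1)) e2 ≈E eD (plus (dist e0 e2) (dist e1 e2)))
    × (dist1 one e ≈E e)
    × (dist1 c1 (dist1 c2 (eD d)) ≈E dist1 (times c1 c2) (eD d))
    × (dist1 c1 (dist1 c2 e) ≈E dist1 (times c1 c2) e)
    × (dist1 c (dist (eD d) e) ≈E dist (dist1 c (eD d)) e)
    × (dist1 c (dist e1 e2) ≈E dist (dist1 c e1) e2)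
    × (dist (eD d) (dist e1 e2) ≈E dist (dist (eD d) e1) e2)
    × (dist e1 (dist e2 e3) ≈E dist (dist e1 e2) e3)
    × (exp c (eC one) ≈C c)
    × (exp (times c1 c2) e ≈C times (exp c1 e) (exp c2 e))
    × (exp1 b (eD (plus (eD d) e)) ≈C times (exp1 b (eD d)) (exp1 b e))
    × (exp1 b (eD (plus e1 e2)) ≈C times (exp1 b e1) (exp1 b e2))
    × (exp1 b (dist e1 e2) ≈C exp (exp1 b e1) e2)
    × (exp c (dist e1 e2) ≈C exp (exp c e1) e2)
    × (exp c (eD (plus e1 e2)) ≈C times (exp c e1) (exp c e2))
    × (exp c (dist (eD (plus e1 e2)) e3) ≈C times (exp c (dist e1 e3)) (exp c (dist e2 e3)))
lemma2 P b c c1 c2 c3 d e e0 e1 e2 e3 =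
    ≡⇒≈C (times-identityʳ c)
  , ≡⇒≈C (times-assoc c1 c2 c3)
  , ≡⇒≈E (cong eD (plus-assoc (eD d) e2 e3))
  , ≡⇒≈E (cong eD (plus-assoc e1 e2 e3))
  , ≡⇒≈E (dist1-plus c (eD d) e)
  , ≡⇒≈E (dist1-plus c e1 e2)
  , ≡⇒≈E (dist-plus (eD d) e1 e2)
  , ≡⇒≈E (dist-plus e0 e1 e2)
  , ≡⇒≈E (dist1-identityˡ e)
  , ≡⇒≈E (dist1-times c1 c2 (eD d))
  , ≡⇒≈E (dist1-times c1 c2 e)
  , ≡⇒≈E (dist1-dist c (eD d) e)
  , ≡⇒≈E (dist1-dist c e1 e2)
  , ≡⇒≈E (dist-assoc (eD d) e1 e2)
  , ≡⇒≈E (dist-assoc e1 e2 e3)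
  , ≡⇒≈C (exp-identityʳ c)
  , ≡⇒≈C (exp-times c1 c2 e)
  , ≡⇒≈C (exp1-plus b (eD d) e)
  , ≡⇒≈C (exp1-plus b e1 e2)
  , ≡⇒≈C (exp1-dist b e1 e2)
  , ≡⇒≈C (exp-dist c e1 e2)
  , exp-plus c e1 e2
  ,
    transC (≡⇒≈C (cong (exp c) (dist-plus e1 e2 e3))) (exp-plus c (dist e1 e3) (dist e2 e3))
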